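{- Let $k\geq 1$, $M$ a finite set of positive integers, $T\in\mathcal{T}_M(k)$ and $x\in M$. Then $\Phi_x(T)\in\mathcal{T}_M(k)$. Moreover, the node labeled $x$ is an old internal node of $T$ if and only if the node labeled $x$ is a young leaf of $\Phi_x(T)$, and for every label $y\neq x$, the node labeled $y$ has the same type in $\Phi_x(T)$ as in $T$ (old or young, leaf or internal node).
   Context: Trees: all trees are ordered (plane) rooted trees; the level of a node is its distance from the root (root at level 0); a leaf is a node with no children. An even $k$-ary tree is an ordered tree in which every node on an even level has exactly $k$ children. A pruned even $k$-ary tree is obtained from an even $k$-ary tree by deleting, for every even-level node all of whose children are leaves, all those children. An increasing pruned even $k$-ary tree on $M$ is a pruned even $k$-ary tree whose nodes on even levels are labeled bijectively by $M$ (odd-level nodes unlabeled) such that labels increase along every path from the root downward and, for each node, the labels of its children increase from left to right; $\mathcal{T}_M(k)$ is the set of them. A labeled node is a leaf if it has no children and an internal node otherwise. For a labeled node $v$, its grand parent is the labeled node $u$ such that a child of $u$ is the parent of $v$ ($v$ is a grand child of $u$). A labeled non-root node $v$ is old if its label is the greatest among all grand children of its grand parent, and young otherwise; the root is neither old nor young. The map $\Phi_x$: let $v$ be the node labeled $x$ in $T$. (i) If $v$ is an old internal node, let $u$ be its grand parent, $\mu_1,\dots,\mu_k$ the children of $u$ from left to right, and $\nu_1,\dots,\nu_k$ the children of $v$ from left to right; for each $j\in[k]$ delete $\nu_j$ (and its edge to $v$) and attach the subtrees rooted at the children of $\nu_j$ as subtrees of $\mu_j$, ordering the children of $\mu_j$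 increasingly from left to right; the result is $\Phi_x(T)$. (ii) If $v$ is a young leaf, let $u$ be its grand parent and $\mu_1,\dots,\mu_k$ the children of $u$ from left to right; for $j\in[k]$ let $F_j$ be the set of subtrees of $\mu_j$ whose roots have labels greater than $x$. Attach $k$ new unlabeled children $\nu_1,\dots,\nu_k$ (left to right) to $v$, and for each $j$ remove the subtrees in $F_j$ from $\mu_j$ and attach them to $\nu_j$, ordering the children of $\nu_j$ increasingly; the result is $\Phi_x(T)$. (iii) Otherwise $\Phi_x(T)=T$. -}

module Defs where

open import Data.Nat using (ℕ; zero; suc; _<_; _≤ᵇ_; _<ᵇ_; _≡ᵇ_; _⊔_)
open import Data.Bool using (Bool; true; false; if_then_else_; not)
open import Data.List using (List; []; _∷_; _++_; map; foldr)
open import Data.Vec using (Vec; []; _∷_; zipWith)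
import Data.Vec as V
open import Data.Vec.Relation.Unary.Any using (Any)
open import Data.List.Relation.Unary.Linked using (Linked)
open import Data.List.Relation.Unary.Unique.Propositional using (Unique)
open import Data.List.Relation.Unary.All using (All)
open import Data.List.Relation.Binary.Permutation.Propositional using (_↭_)
open import Data.Maybe using (Maybe; just; nothing; _<∣>_)
open import Data.Product using (_×_; _,_)
open import Data.Unit using (⊤)
open import Relation.Binary.PropositionalEquality using (_≡_; _≢_)

-- Only even-level (labeled) nodes are
-- represented explicitly.  'leaf x' is a labeled node without children;
-- 'node x v' is a labeled node with exactly k (unlabeled, odd-level)
-- children, the j-th of which has the ordered list 'lookup v j' of
-- labeled subtrees as its children.
data Tree (k : ℕ) : Set where
  leaf : ℕ → Tree k
  node : ℕ → Vec (List (Tree k)) k → Tree k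

module _ {k : ℕ} where

  root : Tree k → ℕ
  root (leaf x)   = x
  root (node x _) = x

  mutual
    labels : Tree k → List ℕ
    labels (leaf x)   = x ∷ []
    labels (node x v) = x ∷ labelsV v

    labelsV : ∀ {n} → Vec (List (Tree k)) n → List ℕ
    labelsV []      = []
    labelsV (l ∷ v) = labelsL l ++ labelsV v

    labelsL : List (Tree k) → List ℕ
    labelsL []       = []
    labelsL (t ∷ ts) = labels t ++ labelsL ts

  -- pruned: a labeled node with k children does not have all its
  -- children being leaves (i.e. some odd-level child has a child)
  mutual
    Pruned : Tree k → Set
    Pruned (leaf x)   = ⊤
    Pruned (node x v) = Any (λ l → l ≢ []) v × PrunedV v

    PrunedV : ∀ {n} → Vec (List (Tree k)) n → Set
    PrunedV []      = ⊤
    PrunedV (l ∷ v) = PrunedL l × PrunedV v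

    PrunedL : List (Tree k) → Set
    PrunedL []       = ⊤
    PrunedL (t ∷ ts) = Pruned t × PrunedL ts

  -- increasing labeling: labels increase from a labeled node to its
  -- grand children, and the (labeled) children of every odd-level node
  -- increase from left to right
  mutual
    Increasing : Tree k → Set
    Increasing (leaf x)   = ⊤
    Increasing (node x v) = IncV x v

    IncV : ∀ {n} → ℕ → Vec (List (Tree k)) n → Set
    IncV x []      = ⊤
    IncV x (l ∷ v) = Linked _<_ (map root l) × IncL x l × IncV x v

    IncL : ℕ → List (Tree k) → Set
    IncL x []       = ⊤
    IncL x (t ∷ ts) = x < root t × Increasing t × IncL x ts

  -- membership in T_M(k); M is a finite set of positive integers given as
  -- a duplicate-free list of positive numbers (see InTM below)
  InT : List ℕ → Tree k → Set
  InT M T = Pruned T × Increasing T × labels T ↭ M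

  gcs : ∀ {n} → Vec (List (Tree k)) n → List (Tree k)
  gcs []      = []
  gcs (l ∷ v) = l ++ gcs v

  maxGC : ∀ {n} → Vec (List (Tree k)) n → ℕ
  maxGC v = foldr _⊔_ 0 (map root (gcs v))

data Kind : Set where
  isRoot old young : Kind

data Shape : Set where
  leafS internalS : Shape

module _ {k : ℕ} where

  -- a grand child t of a node whose grand children have maximal label m
  kindOf : ℕ → Tree k → Kind
  kindOf m t = if m ≤ᵇ root t then old else young

  mutual
    statusK : Kind → Tree k → ℕ → Maybe (Kind × Shape)
    statusK κ (leaf y) x   = if y ≡ᵇ x then just (κ , leafS) else nothing
    statusK κ (node y v) x =
      if y ≡ᵇ x then just (κ , internalS) else statusV (maxGC v) v x

    statusV : ∀ {n} → ℕ → Vec (List (Tree k)) n → ℕ → Maybe (Kind × Shape)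
    statusV m []      x = nothing
    statusV m (l ∷ v) x = statusL m l x <∣> statusV m v x

    statusL : ℕ → List (Tree k) → ℕ → Maybe (Kind × Shape)
    statusL m []       x = nothing
    statusL m (t ∷ ts) x = statusK (kindOf m t) t x <∣> statusL m ts x

  status : Tree k → ℕ → Maybe (Kind × Shape)
  status T = statusK isRoot T

  OldInternal : Tree k → ℕ → Set
  OldInternal T x = status T x ≡ just (old , internalS)

  YoungLeaf : Tree k → ℕ → Set
  YoungLeaf T x = status T x ≡ just (young , leafS)

  filterB : (Tree k → Bool) → List (Tree k) → List (Tree k)
  filterB p []       = []
  filterB p (t ∷ ts) = if p t then t ∷ filterB p ts else filterB p ts

  insertT : Tree k → List (Tree k) → List (Tree k)
  insertT t []       = t ∷ []
  insertT t (s ∷ ss) = if root t ≤ᵇ root s then t ∷ s ∷ ss else s ∷ insertT t ss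

  sortT : List (Tree k) → List (Tree k)
  sortT []       = []
  sortT (t ∷ ts) = insertT t (sortT ts)

  lookupRoot : ℕ → List (Tree k) → Maybe (Tree k)
  lookupRoot x []       = nothing
  lookupRoot x (t ∷ ts) = if root t ≡ᵇ x then just t else lookupRoot x ts

  -- the operation of Φ_x at the grand parent u = node y v of the node v_x
  localOp : ℕ → ℕ → Vec (List (Tree k)) k → Tree k
  localOp x y v with lookupRoot x (gcs v)
  ... | nothing = node y v
  -- (i) old internal node: move the children of ν_j to μ_j
  ... | just (node _ w) =
    if maxGC v ≤ᵇ x
    then node y (zipWith (λ l wl → sortT (map collapse l ++ wl)) v w)
    else node y v
    where
      collapse : Tree k → Tree k
      collapse t = if root t ≡ᵇ x then leaf x else t
  -- (ii) young leaf: move the subtrees of μ_j with labels > x to new ν_j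
  ... | just (leaf _) =
    if maxGC v ≤ᵇ x
    then node y v
    else node y (V.map (λ l → map expand (filterB (λ t → root t ≤ᵇ x) l)) v)
    where
      expand : Tree k → Tree k
      expand t = if root t ≡ᵇ x
                 then node x (V.map (λ l → sortT (filterB (λ s → x <ᵇ root s) l)) v)
                 else t

  isGC : ℕ → Vec (List (Tree k)) k → Bool
  isGC x v with lookupRoot x (gcs v)
  ... | nothing = false
  ... | just _  = true

  mutual
    Φ : ℕ → Tree k → Tree k
    Φ x (leaf y)   = leaf y
    Φ x (node y v) = if isGC x v then localOp x y v else node y (ΦV x v)

    ΦV : ∀ {n} → ℕ → Vec (List (Tree k)) n → Vec (List (Tree k)) n
    ΦV x []      = []
    ΦV x (l ∷ v) = ΦL x l ∷ ΦV x v

    ΦL : ℕ → List (Tree k) → List (Tree k)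
    ΦL x []       = []
    ΦL x (t ∷ ts) = Φ x t ∷ ΦL x ts

-- Φₓ acts only at the grand parent y of the node x. In case (i) the old internal node x
-- collapses to a leaf and its grand children join those of y; in case (ii) the young leaf x
-- becomes internal and adopts the grand children of y exceeding x. All other nodes keep their
-- kind because, wherever a moved node lands, the maximal grand child label is unchanged:
-- in (i) every grand child of y is at most x, below the grand children of x; in (ii) the
-- maximal grand child of y exceeds x and moves along.

module Submission where

open import Defs
open import Data.Bool using (Bool; true; false; if_then_else_; not; T)
open import Data.Bool.Properties using (T-≡)
open import Data.Empty using (⊥-elim)
open import Data.List using (List; []; _∷_; _++_; map; foldr)
open import Data.List.Properties using (map-++; ++-assoc; ++-identityʳ; map-∘; map-cong-local; map-id-local)
open import Data.List.Membership.Propositional using (_∈_; _∉_)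
open import Data.List.Membership.Propositional.Properties using (∈-++⁺ˡ; ∈-++⁺ʳ; ∈-++⁻; ∈-map⁺)
open import Data.List.Relation.Unary.All as All using (All; []; _∷_)
import Data.List.Relation.Unary.All.Properties as Allₚ
open import Data.List.Relation.Unary.AllPairs using (AllPairs; []; _∷_)
import Data.List.Relation.Unary.AllPairs.Properties as AllPairsₚ
open import Data.List.Relation.Unary.Any using (here; there)
open import Data.List.Relation.Unary.Any.Properties using (¬Any[])
open import Data.List.Relation.Unary.Linked using (Linked)
open import Data.List.Relation.Unary.Linked.Properties using (AllPairs⇒Linked; Linked⇒AllPairs)
open import Data.List.Relation.Unary.Unique.Propositional using (Unique)
open import Data.List.Relation.Binary.Disjoint.Propositional using (Disjoint)
open import Data.List.Relation.Binary.Permutation.Propositional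
  using (_↭_; refl; prep; swap; trans; ↭-sym; ↭-reflexive; ↭⇒↭ₛ; module PermutationReasoning)
open import Data.List.Relation.Binary.Permutation.Propositional.Properties
  using (All-resp-↭; ∈-resp-↭; ++⁺ˡ; ++⁺ʳ; ++⁺; ++-comm; shift; shifts)
import Data.List.Relation.Binary.Permutation.Setoid.Properties as Permₛ
open import Data.Maybe using (Maybe; just; nothing; _<∣>_)
open import Data.Maybe.Properties using (<∣>-assoc; <∣>-identityʳ)
open import Data.Nat using (ℕ; _≤_; _<_; _≤ᵇ_; _<ᵇ_; _≡ᵇ_; _⊔_; _≟_; z≤n)
open import Data.Nat.Properties
open import Data.Product using (_×_; _,_; proj₁; proj₂; ∃)
open import Data.Sum using (inj₁; inj₂)
open import Data.Unit using (tt)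
open import Data.Vec using (Vec; []; _∷_; zipWith)
import Data.Vec as V
open import Data.Vec.Relation.Unary.Any as VAny using (here; there)
open import Data.Vec.Relation.Unary.All using ([]; _∷_) renaming (All to VAll)
open import Function.Bundles using (_⇔_; mk⇔; Equivalence)
open import Relation.Binary.PropositionalEquality
  using (_≡_; _≢_; refl; sym; ≢-sym; cong; cong₂; subst; subst₂; setoid; module ≡-Reasoning)
  renaming (trans to ≡-trans)
open import Relation.Nullary using (¬_; yes; no)
open import Data.List.Membership.DecPropositional _≟_ using (_∈?_)

¬T⇒≡false : ∀ {b} → ¬ T b → b ≡ false
¬T⇒≡false {true}  ¬b = ⊥-elim (¬b tt)
¬T⇒≡false {false} _  = refl

≡false⇒¬T : ∀ {b} → b ≡ false → ¬ T b
≡false⇒¬T refl ()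

≤⇒≤ᵇ≡true : ∀ {m n} → m ≤ n → (m ≤ᵇ n) ≡ true
≤⇒≤ᵇ≡true m≤n = Equivalence.to T-≡ (≤⇒≤ᵇ m≤n)

>⇒≤ᵇ≡false : ∀ {m n} → n < m → (m ≤ᵇ n) ≡ false
>⇒≤ᵇ≡false {m} {n} n<m = ¬T⇒≡false (λ b → <⇒≱ n<m (≤ᵇ⇒≤ m n b))

≤ᵇ≡true⇒≤ : ∀ {m n} → (m ≤ᵇ n) ≡ true → m ≤ n
≤ᵇ≡true⇒≤ {m} {n} e = ≤ᵇ⇒≤ m n (Equivalence.from T-≡ e)

≤ᵇ≡false⇒> : ∀ {m n} → (m ≤ᵇ n) ≡ false → n < m
≤ᵇ≡false⇒> e = ≰⇒> (λ m≤n → ≡false⇒¬T e (≤⇒≤ᵇ m≤n))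

<ᵇ≡true⇒< : ∀ {m n} → (m <ᵇ n) ≡ true → m < n
<ᵇ≡true⇒< {m} {n} e = <ᵇ⇒< m n (Equivalence.from T-≡ e)

≡ᵇ-refl : ∀ n → (n ≡ᵇ n) ≡ true
≡ᵇ-refl n = Equivalence.to T-≡ (≡⇒≡ᵇ n n refl)

≢⇒≡ᵇ≡false : ∀ {m n} → m ≢ n → (m ≡ᵇ n) ≡ false
≢⇒≡ᵇ≡false {m} {n} m≢n = ¬T⇒≡false (λ b → m≢n (≡ᵇ⇒≡ m n b))

≡ᵇ≡true⇒≡ : ∀ {m n} → (m ≡ᵇ n) ≡ true → m ≡ n
≡ᵇ≡true⇒≡ {m} {n} e = ≡ᵇ⇒≡ m n (Equivalence.from T-≡ e)

module _ {A : Set} where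

  Unique-++⁻ : ∀ (xs : List A) {ys} → Unique (xs ++ ys) →
    Unique xs × Unique ys × Disjoint xs ys
  Unique-++⁻ []       u          = [] , u , λ ()
  Unique-++⁻ (a ∷ xs) (a∉ ∷ u) with Unique-++⁻ xs u
  ... | u₁ , u₂ , disjoint = Allₚ.++⁻ˡ xs a∉ ∷ u₁ , u₂ , λ where
    (here refl , j) → All.lookup (Allₚ.++⁻ʳ xs a∉) j refl
    (there i   , j) → disjoint (i , j)

  Unique-resp-↭ : ∀ {xs ys : List A} → xs ↭ ys → Unique xs → Unique ys
  Unique-resp-↭ p = Permₛ.Unique-resp-↭ (setoid A) (↭⇒↭ₛ p)

  ++-interchange-↭ : ∀ (as bs cs ds : List A) → (as ++ bs) ++ (cs ++ ds) ↭ (as ++ cs) ++ (bs ++ ds)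
  ++-interchange-↭ as bs cs ds =
    trans (↭-reflexive (++-assoc as bs (cs ++ ds)))
      (trans (++⁺ˡ as (shifts bs cs)) (↭-reflexive (sym (++-assoc as cs (bs ++ ds)))))

-- Relates the status of x before and after Φₓ. Keeping track of absence makes the relation
-- compatible with _<∣>_, which is how statuses of sibling subtrees are combined.
data StatusMatch : Maybe (Kind × Shape) → Maybe (Kind × Shape) → Set where
  absent                : StatusMatch nothing nothing
  oldInternal↦youngLeaf : StatusMatch (just (old , internalS)) (just (young , leafS))
  unrelated             : ∀ {a b} → a ≢ (old , internalS) → b ≢ (young , leafS) → StatusMatch (just a) (just b)

StatusMatch-<∣> : ∀ {a₁ b₁ a₂ b₂} → StatusMatch a₁ b₁ → StatusMatch a₂ b₂ →
  StatusMatch (a₁ <∣> a₂) (b₁ <∣> b₂)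
StatusMatch-<∣> absent                m = m
StatusMatch-<∣> oldInternal↦youngLeaf _ = oldInternal↦youngLeaf
StatusMatch-<∣> (unrelated ¬oi ¬yl)   _ = unrelated ¬oi ¬yl

StatusMatch⇒⇔ : ∀ {a b} → StatusMatch a b → (a ≡ just (old , internalS) ⇔ b ≡ just (young , leafS))
StatusMatch⇒⇔ absent                = mk⇔ (λ ()) (λ ())
StatusMatch⇒⇔ oldInternal↦youngLeaf = mk⇔ (λ _ → refl) (λ _ → refl)
StatusMatch⇒⇔ (unrelated ¬oi ¬yl)   = mk⇔ (λ { refl → ⊥-elim (¬oi refl) }) (λ { refl → ⊥-elim (¬yl refl) })

module _ {k : ℕ} where

  shape : Tree k → Shape
  shape (leaf _)   = leafS
  shape (node _ _) = internalS

  maxRoot : List (Tree k) → ℕ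
  maxRoot l = foldr _⊔_ 0 (map root l)

  labelsL-++ : ∀ (l l′ : List (Tree k)) → labelsL (l ++ l′) ≡ labelsL l ++ labelsL l′
  labelsL-++ []       l′ = refl
  labelsL-++ (t ∷ ts) l′ = ≡-trans (cong (labels t ++_) (labelsL-++ ts l′))
                                  (sym (++-assoc (labels t) (labelsL ts) (labelsL l′)))

  labelsV≡labelsL-gcs : ∀ {n} (v : Vec (List (Tree k)) n) → labelsV v ≡ labelsL (gcs v)
  labelsV≡labelsL-gcs []      = refl
  labelsV≡labelsL-gcs (l ∷ v) = ≡-trans (cong (labelsL l ++_) (labelsV≡labelsL-gcs v))
                                        (sym (labelsL-++ l (gcs v)))

  root∈labels : ∀ (t : Tree k) → root t ∈ labels t
  root∈labels (leaf _)   = here refl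
  root∈labels (node _ _) = here refl

  ∈-labelsL⁺ : ∀ {t : Tree k} {l z} → t ∈ l → z ∈ labels t → z ∈ labelsL l
  ∈-labelsL⁺ {l = t ∷ ts} (here refl) z∈t = ∈-++⁺ˡ z∈t
  ∈-labelsL⁺ {l = t ∷ ts} (there i)   z∈t = ∈-++⁺ʳ (labels t) (∈-labelsL⁺ i z∈t)

  ∈-labelsL⁻ : ∀ {l : List (Tree k)} {z} → z ∈ labelsL l → ∃ λ t → t ∈ l × z ∈ labels t
  ∈-labelsL⁻ {t ∷ ts} z∈l with ∈-++⁻ (labels t) z∈l
  ... | inj₁ z∈t  = t , here refl , z∈t
  ... | inj₂ z∈ts with ∈-labelsL⁻ {ts} z∈ts
  ...   | s , s∈ts , z∈s = s , there s∈ts , z∈s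

  labelsL-↭ : ∀ {l l′ : List (Tree k)} → l ↭ l′ → labelsL l ↭ labelsL l′
  labelsL-↭ refl         = refl
  labelsL-↭ (prep t p)   = ++⁺ˡ (labels t) (labelsL-↭ p)
  labelsL-↭ (swap s t p) =
    trans (shifts (labels s) (labels t)) (++⁺ˡ (labels t) (++⁺ˡ (labels s) (labelsL-↭ p)))
  labelsL-↭ (trans p q)  = trans (labelsL-↭ p) (labelsL-↭ q)

  roots-map : ∀ {f : Tree k → Tree k} → (∀ t → root (f t) ≡ root t) → ∀ l → map root (map f l) ≡ map root l
  roots-map f-root l = ≡-trans (sym (map-∘ l)) (map-cong-local (All.tabulate (λ {t} _ → f-root t)))

  labelsL-map : ∀ (f : Tree k → Tree k) {l} → All (λ t → labels (f t) ↭ labels t) l →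
    labelsL (map f l) ↭ labelsL l
  labelsL-map f []       = refl
  labelsL-map f (p ∷ ps) = ++⁺ p (labelsL-map f ps)

  labels-node-↭ : ∀ y {v v′ : Vec (List (Tree k)) k} → labelsL (gcs v′) ↭ labelsL (gcs v) →
    labels (node y v′) ↭ labels (node y v)
  labels-node-↭ y {v} {v′} p =
    prep y (subst₂ _↭_ (sym (labelsV≡labelsL-gcs v′)) (sym (labelsV≡labelsL-gcs v)) p)

  Unique-labels-∈ : ∀ {l : List (Tree k)} {t} → Unique (labelsL l) → t ∈ l → Unique (labels t)
  Unique-labels-∈ {t ∷ ts} u (here refl) = proj₁ (Unique-++⁻ (labels t) u)
  Unique-labels-∈ {t ∷ ts} u (there i)   = Unique-labels-∈ (proj₁ (proj₂ (Unique-++⁻ (labels t) u))) i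

  DistinctRoots : List (Tree k) → Set
  DistinctRoots = AllPairs (λ a b → root a ≢ root b)

  Unique-labels⇒DistinctRoots : ∀ {l : List (Tree k)} → Unique (labelsL l) → DistinctRoots l
  Unique-labels⇒DistinctRoots {[]}     _ = []
  Unique-labels⇒DistinctRoots {t ∷ ts} u with Unique-++⁻ (labels t) u
  ... | _ , u-ts , disjoint =
    All.tabulate (λ {s} s∈ts e →
      disjoint (root∈labels t , subst (_∈ labelsL ts) (sym e) (∈-labelsL⁺ s∈ts (root∈labels s))))
    ∷ Unique-labels⇒DistinctRoots u-ts

  root-injective : ∀ {l : List (Tree k)} {a b} → DistinctRoots l → a ∈ l → b ∈ l → root a ≡ root b → a ≡ b
  root-injective _          (here refl) (here refl) _ = refl
  root-injective (a∉ ∷ _)   (here refl) (there j)   e = ⊥-elim (All.lookup a∉ j e)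
  root-injective (b∉ ∷ _)   (there i)   (here refl) e = ⊥-elim (All.lookup b∉ i (sym e))
  root-injective (_ ∷ dist) (there i)   (there j)   e = root-injective dist i j e

  ≤-maxRoot : ∀ {l : List (Tree k)} {t} → t ∈ l → root t ≤ maxRoot l
  ≤-maxRoot {s ∷ ss} (here refl) = m≤m⊔n (root s) (maxRoot ss)
  ≤-maxRoot {s ∷ ss} (there i)   = ≤-trans (≤-maxRoot i) (m≤n⊔m (root s) (maxRoot ss))

  maxRoot-≤ : ∀ {l : List (Tree k)} {a} → All (λ t → root t ≤ a) l → maxRoot l ≤ a
  maxRoot-≤ []       = z≤n
  maxRoot-≤ (p ∷ ps) = ⊔-lub p (maxRoot-≤ ps)

  maxRoot-≤⁻ : ∀ {l : List (Tree k)} {a} → maxRoot l ≤ a → All (λ t → root t ≤ a) l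
  maxRoot-≤⁻ max≤a = All.tabulate (λ i → ≤-trans (≤-maxRoot i) max≤a)

  <-maxRoot⁻ : ∀ {l : List (Tree k)} {a} → a < maxRoot l → ∃ λ t → t ∈ l × a < root t
  <-maxRoot⁻ {s ∷ ss} {a} a<max with a <? root s
  ... | yes a<s = s , here refl , a<s
  ... | no  a≮s with <-maxRoot⁻ {ss} (≰⇒> (λ max≤a → <⇒≱ a<max (⊔-lub (≮⇒≥ a≮s) max≤a)))
  ...   | t , t∈ss , a<t = t , there t∈ss , a<t

  maxRoot-cofinal : ∀ {l l′ : List (Tree k)} → (∀ {t} → t ∈ l → t ∈ l′) →
    All (λ t → root t ≤ maxRoot l) l′ → maxRoot l′ ≡ maxRoot l
  maxRoot-cofinal l⊆l′ bounded =
    ≤-antisym (maxRoot-≤ bounded) (maxRoot-≤ (All.tabulate (λ t∈l → ≤-maxRoot (l⊆l′ t∈l))))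

  kindOf-old : ∀ {m} (t : Tree k) → m ≤ root t → kindOf m t ≡ old
  kindOf-old t m≤t rewrite ≤⇒≤ᵇ≡true m≤t = refl

  kindOf-young : ∀ {m} (t : Tree k) → root t < m → kindOf m t ≡ young
  kindOf-young t t<m rewrite >⇒≤ᵇ≡false t<m = refl

  kindOf-young-cong : ∀ {m m′} (t : Tree k) → root t < m → root t < m′ → kindOf m t ≡ kindOf m′ t
  kindOf-young-cong t t<m t<m′ = ≡-trans (kindOf-young t t<m) (sym (kindOf-young t t<m′))

  statusL-++ : ∀ m (l l′ : List (Tree k)) z →
    statusL m (l ++ l′) z ≡ (statusL m l z <∣> statusL m l′ z)
  statusL-++ m []       l′ z = refl
  statusL-++ m (t ∷ ts) l′ z =
    ≡-trans (cong (statusK (kindOf m t) t z <∣>_) (statusL-++ m ts l′ z))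
            (sym (<∣>-assoc (statusK (kindOf m t) t z) (statusL m ts z) (statusL m l′ z)))

  statusV≡statusL-gcs : ∀ {n} m (v : Vec (List (Tree k)) n) z → statusV m v z ≡ statusL m (gcs v) z
  statusV≡statusL-gcs m []      z = refl
  statusV≡statusL-gcs m (l ∷ v) z =
    ≡-trans (cong (statusL m l z <∣>_) (statusV≡statusL-gcs m v z)) (sym (statusL-++ m l (gcs v) z))

  statusK-node : ∀ κ y (v : Vec (List (Tree k)) k) z → y ≢ z →
    statusK κ (node y v) z ≡ statusL (maxGC v) (gcs v) z
  statusK-node κ y v z y≢z rewrite ≢⇒≡ᵇ≡false y≢z = statusV≡statusL-gcs (maxGC v) v z

  statusK-root : ∀ κ (t : Tree k) → statusK κ t (root t) ≡ just (κ , shape t)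
  statusK-root κ (leaf y)   rewrite ≡ᵇ-refl y = refl
  statusK-root κ (node y v) rewrite ≡ᵇ-refl y = refl

  mutual
    statusK-∉ : ∀ κ (t : Tree k) z → z ∉ labels t → statusK κ t z ≡ nothing
    statusK-∉ κ (leaf y)   z z∉ rewrite ≢⇒≡ᵇ≡false {y} {z} (λ e → z∉ (here (sym e))) = refl
    statusK-∉ κ (node y v) z z∉ rewrite ≢⇒≡ᵇ≡false {y} {z} (λ e → z∉ (here (sym e))) =
      statusV-∉ (maxGC v) v z (λ i → z∉ (there i))

    statusV-∉ : ∀ {n} m (v : Vec (List (Tree k)) n) z → z ∉ labelsV v → statusV m v z ≡ nothing
    statusV-∉ m []      z z∉ = refl
    statusV-∉ m (l ∷ v) z z∉ rewrite statusL-∉ m l z (λ i → z∉ (∈-++⁺ˡ i)) =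
      statusV-∉ m v z (λ i → z∉ (∈-++⁺ʳ (labelsL l) i))

    statusL-∉ : ∀ m (l : List (Tree k)) z → z ∉ labelsL l → statusL m l z ≡ nothing
    statusL-∉ m []       z z∉ = refl
    statusL-∉ m (t ∷ ts) z z∉ rewrite statusK-∉ (kindOf m t) t z (λ i → z∉ (∈-++⁺ˡ i)) =
      statusL-∉ m ts z (λ i → z∉ (∈-++⁺ʳ (labels t) i))

  statusL-∉-↭ : ∀ m m′ {l l′ : List (Tree k)} z → labelsL l′ ↭ labelsL l → z ∉ labelsL l →
    statusL m′ l′ z ≡ statusL m l z
  statusL-∉-↭ m m′ {l} {l′} z l′↭l z∉ =
    ≡-trans (statusL-∉ m′ l′ z (λ z∈ → z∉ (∈-resp-↭ l′↭l z∈))) (sym (statusL-∉ m l z z∉))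

  statusL-∈ : ∀ m {l : List (Tree k)} {t} z → Unique (labelsL l) → t ∈ l → z ∈ labels t →
    statusL m l z ≡ statusK (kindOf m t) t z
  statusL-∈ m {t ∷ ts} z u (here refl) z∈t
    rewrite statusL-∉ m ts z (λ z∈ts → proj₂ (proj₂ (Unique-++⁻ (labels t) u)) (z∈t , z∈ts)) =
      <∣>-identityʳ (statusK (kindOf m t) t z)
  statusL-∈ m {t ∷ ts} z u (there i) z∈s with Unique-++⁻ (labels t) u
  ... | _ , u-ts , disjoint
    rewrite statusK-∉ (kindOf m t) t z (λ z∈t → disjoint (z∈t , ∈-labelsL⁺ i z∈s)) =
      statusL-∈ m z u-ts i z∈s

  statusK-grandchild : ∀ κ y (v : Vec (List (Tree k)) k) {g} z → Unique (labelsL (gcs v)) →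
    g ∈ gcs v → z ∈ labels g → y ≢ z →
    statusK κ (node y v) z ≡ statusK (kindOf (maxGC v) g) g z
  statusK-grandchild κ y v z u g∈ z∈g y≢z =
    ≡-trans (statusK-node κ y v z y≢z) (statusL-∈ (maxGC v) z u g∈ z∈g)

  statusK-grandchild-root : ∀ κ y (v : Vec (List (Tree k)) k) {g} → Unique (labelsL (gcs v)) →
    g ∈ gcs v → y ≢ root g → statusK κ (node y v) (root g) ≡ just (kindOf (maxGC v) g , shape g)
  statusK-grandchild-root κ y v {g} u g∈ y≢g =
    ≡-trans (statusK-grandchild κ y v (root g) u g∈ (root∈labels g) y≢g) (statusK-root _ g)

  statusL-map : ∀ (f : Tree k → Tree k) m z {l} →
    All (λ t → root (f t) ≡ root t × (∀ κ → statusK κ (f t) z ≡ statusK κ t z)) l →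
    statusL m (map f l) z ≡ statusL m l z
  statusL-map f m z []                   = refl
  statusL-map f m z {t ∷ _} ((r , e) ∷ ps) rewrite r | e (kindOf m t) | statusL-map f m z ps = refl

  statusK-node-cong : ∀ κ y {v v′ : Vec (List (Tree k)) k} z →
    (y ≢ z → statusL (maxGC v′) (gcs v′) z ≡ statusL (maxGC v) (gcs v) z) →
    statusK κ (node y v′) z ≡ statusK κ (node y v) z
  statusK-node-cong κ y {v} {v′} z same with y ≟ z
  ... | yes refl rewrite ≡ᵇ-refl y = refl
  ... | no y≢z = begin
    statusK κ (node y v′) z            ≡⟨ statusK-node κ y v′ z y≢z ⟩
    statusL (maxGC v′) (gcs v′) z      ≡⟨ same y≢z ⟩
    statusL (maxGC v) (gcs v) z        ≡⟨ sym (statusK-node κ y v z y≢z) ⟩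
    statusK κ (node y v) z             ∎
    where open ≡-Reasoning

  StatusMatch-map : ∀ (f : Tree k → Tree k) m z {l} →
    All (λ t → root (f t) ≡ root t × (∀ κ → StatusMatch (statusK κ t z) (statusK κ (f t) z))) l →
    StatusMatch (statusL m l z) (statusL m (map f l) z)
  StatusMatch-map f m z []                     = absent
  StatusMatch-map f m z {t ∷ _} ((r , e) ∷ ps) rewrite r =
    StatusMatch-<∣> (e (kindOf m t)) (StatusMatch-map f m z ps)

  PrunedL⁻ : ∀ {l : List (Tree k)} → PrunedL l → All Pruned l
  PrunedL⁻ {[]}    _        = []
  PrunedL⁻ {_ ∷ _} (p , ps) = p ∷ PrunedL⁻ ps

  PrunedL⁺ : ∀ {l : List (Tree k)} → All Pruned l → PrunedL l
  PrunedL⁺ []       = tt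
  PrunedL⁺ (p ∷ ps) = p , PrunedL⁺ ps

  PrunedV⁻ : ∀ {n} {v : Vec (List (Tree k)) n} → PrunedV v → All Pruned (gcs v)
  PrunedV⁻ {v = []}    _        = []
  PrunedV⁻ {v = _ ∷ _} (p , ps) = Allₚ.++⁺ (PrunedL⁻ p) (PrunedV⁻ ps)

  PrunedV⁺ : ∀ {n} {v : Vec (List (Tree k)) n} → All Pruned (gcs v) → PrunedV v
  PrunedV⁺ {v = []}    _  = tt
  PrunedV⁺ {v = l ∷ _} ps = PrunedL⁺ (Allₚ.++⁻ˡ l ps) , PrunedV⁺ (Allₚ.++⁻ʳ l ps)

  ∈-gcs⇒nonempty : ∀ {n} {v : Vec (List (Tree k)) n} {t} → t ∈ gcs v → VAny.Any (λ l → l ≢ []) v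
  ∈-gcs⇒nonempty {v = l ∷ _} t∈ with ∈-++⁻ l t∈
  ... | inj₁ t∈l = here (λ { refl → ¬Any[] t∈l })
  ... | inj₂ t∈v = there (∈-gcs⇒nonempty t∈v)

  nonempty⇒∈-gcs : ∀ {n} {v : Vec (List (Tree k)) n} → VAny.Any (λ l → l ≢ []) v → ∃ λ t → t ∈ gcs v
  nonempty⇒∈-gcs {v = []      ∷ _} (here l≢[]) = ⊥-elim (l≢[] refl)
  nonempty⇒∈-gcs {v = (t ∷ _) ∷ _} (here _)    = t , here refl
  nonempty⇒∈-gcs {v = l ∷ _}       (there any) with nonempty⇒∈-gcs any
  ... | t , t∈ = t , ∈-++⁺ʳ l t∈

  Pruned-node⁺ : ∀ y {v : Vec (List (Tree k)) k} {t} → t ∈ gcs v → All Pruned (gcs v) → Pruned (node y v)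
  Pruned-node⁺ y t∈ ps = ∈-gcs⇒nonempty t∈ , PrunedV⁺ ps

  Pruned-node⁻ : ∀ {y} {v : Vec (List (Tree k)) k} → Pruned (node y v) →
    (∃ λ t → t ∈ gcs v) × All Pruned (gcs v)
  Pruned-node⁻ (any , ps) = nonempty⇒∈-gcs any , PrunedV⁻ ps

  Above : ℕ → Tree k → Set
  Above y t = y < root t × Increasing t

  SortedChildren : ∀ {n} → Vec (List (Tree k)) n → Set
  SortedChildren = VAll (λ l → Linked _<_ (map root l))

  IncL⁻ : ∀ {y} {l : List (Tree k)} → IncL y l → All (Above y) l
  IncL⁻ {l = []}    _              = []
  IncL⁻ {l = _ ∷ _} (y< , inc , i) = (y< , inc) ∷ IncL⁻ i

  IncL⁺ : ∀ {y} {l : List (Tree k)} → All (Above y) l → IncL y l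
  IncL⁺ []                = tt
  IncL⁺ ((y< , inc) ∷ as) = y< , inc , IncL⁺ as

  IncV⁻ : ∀ {n y} {v : Vec (List (Tree k)) n} → IncV y v → SortedChildren v × All (Above y) (gcs v)
  IncV⁻ {v = []}    _               = [] , []
  IncV⁻ {v = _ ∷ _} (lin , il , iv) with IncV⁻ iv
  ... | sorted , above = lin ∷ sorted , Allₚ.++⁺ (IncL⁻ il) above

  IncV⁺ : ∀ {n y} {v : Vec (List (Tree k)) n} → SortedChildren v → All (Above y) (gcs v) → IncV y v
  IncV⁺ {v = []}    []             _     = tt
  IncV⁺ {v = l ∷ _} (lin ∷ sorted) above =
    lin , IncL⁺ (Allₚ.++⁻ˡ l above) , IncV⁺ sorted (Allₚ.++⁻ʳ l above)

  WellFormed : Tree k → Set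
  WellFormed t = Pruned t × Increasing t × Unique (labels t)

  Unique-labels-gcs : ∀ {y} {v : Vec (List (Tree k)) k} → Unique (labels (node y v)) →
    Unique (labelsL (gcs v))
  Unique-labels-gcs {v = v} (_ ∷ u) = subst Unique (labelsV≡labelsL-gcs v) u

  WellFormed-gcs : ∀ {y} {v : Vec (List (Tree k)) k} → WellFormed (node y v) → All WellFormed (gcs v)
  WellFormed-gcs {y} {v} (pruned , inc , u) = All.tabulate λ t∈ →
    All.lookup (proj₂ (Pruned-node⁻ {y} {v} pruned)) t∈ ,
    proj₂ (All.lookup (proj₂ (IncV⁻ {v = v} inc)) t∈) ,
    Unique-labels-∈ (Unique-labels-gcs {v = v} u) t∈

  lookupRoot-nothing : ∀ x (l : List (Tree k)) → lookupRoot x l ≡ nothing → All (λ s → root s ≢ x) l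
  lookupRoot-nothing x []       _ = []
  lookupRoot-nothing x (t ∷ ts) e with root t ≡ᵇ x in found
  lookupRoot-nothing x (t ∷ ts) () | true
  ... | false = (λ { refl → ≡false⇒¬T found (Equivalence.from T-≡ (≡ᵇ-refl x)) })
              ∷ lookupRoot-nothing x ts e

  lookupRoot-just : ∀ x (l : List (Tree k)) {s} → lookupRoot x l ≡ just s → s ∈ l × root s ≡ x
  lookupRoot-just x (t ∷ ts) e with root t ≡ᵇ x in found
  lookupRoot-just x (t ∷ ts) refl | true = here refl , ≡ᵇ≡true⇒≡ found
  ... | false with lookupRoot-just x ts e
  ...   | s∈ , r = there s∈ , r

  Sorted : List (Tree k) → Set
  Sorted = AllPairs (λ a b → root a < root b)

  Sorted⇒Linked : ∀ {l : List (Tree k)} → Sorted l → Linked _<_ (map root l)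
  Sorted⇒Linked sorted = AllPairs⇒Linked (AllPairsₚ.map⁺ sorted)

  Linked⇒Sorted : ∀ {l : List (Tree k)} → Linked _<_ (map root l) → Sorted l
  Linked⇒Sorted linked = AllPairsₚ.map⁻ (Linked⇒AllPairs <-trans linked)

  insertT-↭ : ∀ (t : Tree k) l → insertT t l ↭ t ∷ l
  insertT-↭ t []       = refl
  insertT-↭ t (s ∷ ss) with root t ≤ᵇ root s
  ... | true  = refl
  ... | false = trans (prep s (insertT-↭ t ss)) (swap s t refl)

  sortT-↭ : ∀ (l : List (Tree k)) → sortT l ↭ l
  sortT-↭ []       = refl
  sortT-↭ (t ∷ ts) = trans (insertT-↭ t (sortT ts)) (prep t (sortT-↭ ts))

  insertT-Sorted : ∀ (t : Tree k) l → All (λ s → root t ≢ root s) l → Sorted l → Sorted (insertT t l)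
  insertT-Sorted t []       _          _              = [] ∷ []
  insertT-Sorted t (s ∷ ss) (t≢s ∷ ne) (s< ∷ sorted) with root t ≤ᵇ root s in t≤s
  ... | true  = (t<s ∷ All.map (<-trans t<s) s<) ∷ s< ∷ sorted
    where
      t<s : root t < root s
      t<s = ≤∧≢⇒< (≤ᵇ≡true⇒≤ t≤s) t≢s
  ... | false = All-resp-↭ (↭-sym (insertT-↭ t ss)) (≤ᵇ≡false⇒> t≤s ∷ s<)
              ∷ insertT-Sorted t ss ne sorted

  sortT-Sorted : ∀ (l : List (Tree k)) → DistinctRoots l → Sorted (sortT l)
  sortT-Sorted []       _           = []
  sortT-Sorted (t ∷ ts) (t≢ ∷ dist) =
    insertT-Sorted t (sortT ts) (All-resp-↭ (↭-sym (sortT-↭ ts)) t≢) (sortT-Sorted ts dist)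

  sortT-Linked : ∀ (l : List (Tree k)) → Unique (labelsL (sortT l)) → Linked _<_ (map root (sortT l))
  sortT-Linked l u =
    Sorted⇒Linked (sortT-Sorted l (Unique-labels⇒DistinctRoots (Unique-resp-↭ (labelsL-↭ (sortT-↭ l)) u)))

  filterB-++ : ∀ p (l l′ : List (Tree k)) → filterB p (l ++ l′) ≡ filterB p l ++ filterB p l′
  filterB-++ p []       l′ = refl
  filterB-++ p (t ∷ ts) l′ with p t
  ... | true  = cong (t ∷_) (filterB-++ p ts l′)
  ... | false = filterB-++ p ts l′

  filterB-∈⁺ : ∀ p {l : List (Tree k)} {t} → t ∈ l → p t ≡ true → t ∈ filterB p l
  filterB-∈⁺ p {s ∷ _} (here refl) pt rewrite pt = here refl
  filterB-∈⁺ p {s ∷ _} (there i)   pt with p s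
  ... | true  = there (filterB-∈⁺ p i pt)
  ... | false = filterB-∈⁺ p i pt

  filterB-∈⁻ : ∀ p {l : List (Tree k)} {t} → t ∈ filterB p l → t ∈ l × p t ≡ true
  filterB-∈⁻ p {s ∷ _} t∈ with p s in ps
  filterB-∈⁻ p {s ∷ _} (here refl) | true = here refl , ps
  filterB-∈⁻ p {s ∷ _} (there t∈) | true with filterB-∈⁻ p t∈
  ... | t∈l , pt = there t∈l , pt
  filterB-∈⁻ p {s ∷ _} t∈ | false with filterB-∈⁻ p t∈
  ... | t∈l , pt = there t∈l , pt

  filterB-All : ∀ p {P : Tree k → Set} {l} → All P l → All P (filterB p l)
  filterB-All p []                    = []
  filterB-All p {l = t ∷ _} (pt ∷ ps) with p t
  ... | true  = pt ∷ filterB-All p ps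
  ... | false = filterB-All p ps

  filterB-AllPairs : ∀ p {R : Tree k → Tree k → Set} {l} → AllPairs R l → AllPairs R (filterB p l)
  filterB-AllPairs p []                    = []
  filterB-AllPairs p {l = t ∷ _} (rt ∷ rs) with p t
  ... | true  = filterB-All p rt ∷ filterB-AllPairs p rs
  ... | false = filterB-AllPairs p rs

  filterB-complement-↭ : ∀ p q (l : List (Tree k)) → (∀ t → q t ≡ not (p t)) →
    filterB p l ++ filterB q l ↭ l
  filterB-complement-↭ p q []       _ = refl
  filterB-complement-↭ p q (t ∷ ts) q≡¬p with p t | q t | q≡¬p t
  ... | true  | false | _ = prep t (filterB-complement-↭ p q ts q≡¬p)
  ... | false | true  | _ =
    trans (shift t (filterB p ts) (filterB q ts)) (prep t (filterB-complement-↭ p q ts q≡¬p))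

  gcs-zipWith-sortT : ∀ {n} (f : Tree k → Tree k) (a b : Vec (List (Tree k)) n) →
    gcs (zipWith (λ l l′ → sortT (map f l ++ l′)) a b) ↭ map f (gcs a) ++ gcs b
  gcs-zipWith-sortT f []      []      = refl
  gcs-zipWith-sortT f (l ∷ a) (l′ ∷ b) =
    trans (++⁺ (sortT-↭ (map f l ++ l′)) (gcs-zipWith-sortT f a b))
      (trans (++-interchange-↭ (map f l) l′ (map f (gcs a)) (gcs b))
        (↭-reflexive (cong (_++ (l′ ++ gcs b)) (sym (map-++ f l (gcs a))))))

  gcs-map-filterB : ∀ {n} (f : Tree k → Tree k) p (a : Vec (List (Tree k)) n) →
    gcs (V.map (λ l → map f (filterB p l)) a) ≡ map f (filterB p (gcs a))
  gcs-map-filterB f p []      = refl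
  gcs-map-filterB f p (l ∷ a) = begin
    map f (filterB p l) ++ gcs (V.map (λ l → map f (filterB p l)) a)
      ≡⟨ cong (map f (filterB p l) ++_) (gcs-map-filterB f p a) ⟩
    map f (filterB p l) ++ map f (filterB p (gcs a))
      ≡⟨ sym (map-++ f (filterB p l) (filterB p (gcs a))) ⟩
    map f (filterB p l ++ filterB p (gcs a))
      ≡⟨ cong (map f) (sym (filterB-++ p l (gcs a))) ⟩
    map f (filterB p (l ++ gcs a)) ∎
    where open ≡-Reasoning

  gcs-sortT-filterB : ∀ {n} p (a : Vec (List (Tree k)) n) →
    gcs (V.map (λ l → sortT (filterB p l)) a) ↭ filterB p (gcs a)
  gcs-sortT-filterB p []      = refl
  gcs-sortT-filterB p (l ∷ a) =
    trans (++⁺ (sortT-↭ (filterB p l)) (gcs-sortT-filterB p a))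
      (↭-reflexive (sym (filterB-++ p l (gcs a))))

  zipWith-sortT-SortedChildren : ∀ {n} (f : Tree k → Tree k) (a b : Vec (List (Tree k)) n) →
    Unique (labelsV (zipWith (λ l l′ → sortT (map f l ++ l′)) a b)) →
    SortedChildren (zipWith (λ l l′ → sortT (map f l ++ l′)) a b)
  zipWith-sortT-SortedChildren f []      []       _ = []
  zipWith-sortT-SortedChildren f (l ∷ a) (l′ ∷ b) u with Unique-++⁻ (labelsL (sortT (map f l ++ l′))) u
  ... | u₁ , u₂ , _ = sortT-Linked (map f l ++ l′) u₁ ∷ zipWith-sortT-SortedChildren f a b u₂

  map-sortT-SortedChildren : ∀ {n} p (a : Vec (List (Tree k)) n) →
    Unique (labelsV (V.map (λ l → sortT (filterB p l)) a)) →
    SortedChildren (V.map (λ l → sortT (filterB p l)) a)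
  map-sortT-SortedChildren p []      _ = []
  map-sortT-SortedChildren p (l ∷ a) u with Unique-++⁻ (labelsL (sortT (filterB p l))) u
  ... | u₁ , u₂ , _ = sortT-Linked (filterB p l) u₁ ∷ map-sortT-SortedChildren p a u₂

  map-filterB-SortedChildren : ∀ {n} (f : Tree k → Tree k) p {a : Vec (List (Tree k)) n} →
    (∀ t → root (f t) ≡ root t) → SortedChildren a →
    SortedChildren (V.map (λ l → map f (filterB p l)) a)
  map-filterB-SortedChildren f p {[]}    _      []              = []
  map-filterB-SortedChildren f p {l ∷ _} f-root (linked ∷ sorted) =
    subst (Linked _<_) (sym (roots-map f-root (filterB p l))) (Sorted⇒Linked (filterB-AllPairs p (Linked⇒Sorted linked)))
    ∷ map-filterB-SortedChildren f p f-root sorted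

  labelsL-map-at : ∀ (f : Tree k → Tree k) {l s} (as bs : List ℕ) → DistinctRoots l → s ∈ l →
    (∀ t → root t ≢ root s → f t ≡ t) → labels (f s) ++ as ↭ labels s ++ bs →
    labelsL (map f l) ++ as ↭ labelsL l ++ bs
  labelsL-map-at f {s ∷ ts} as bs (s≢ ∷ _) (here refl) f-id fs↭s
    rewrite map-id-local (All.map (λ s≢t → f-id _ (≢-sym s≢t)) s≢) =
      trans (swap-last (labels (f s)) (labelsL ts) as)
        (trans (++⁺ʳ (labelsL ts) fs↭s) (swap-last (labels s) bs (labelsL ts)))
    where
      swap-last : ∀ (xs ys zs : List ℕ) → (xs ++ ys) ++ zs ↭ (xs ++ zs) ++ ys
      swap-last xs ys zs = trans (↭-reflexive (++-assoc xs ys zs))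
        (trans (++⁺ˡ xs (++-comm ys zs)) (↭-reflexive (sym (++-assoc xs zs ys))))
  labelsL-map-at f {t ∷ ts} as bs (t≢ ∷ dist) (there s∈) f-id fs↭s
    rewrite f-id t (All.lookup t≢ s∈) =
      trans (↭-reflexive (++-assoc (labels t) (labelsL (map f ts)) as))
        (trans (++⁺ˡ (labels t) (labelsL-map-at f as bs dist s∈ f-id fs↭s))
          (↭-reflexive (sym (++-assoc (labels t) (labelsL ts) bs))))

  module _ (x : ℕ) where

    -- When x is the root of t, its kind is decided by the grand parent, which is also where
    -- Φₓ acts on it; hence the hypothesis x ≢ root t.
    record Correct (t t′ : Tree k) : Set where
      field
        pruned       : Pruned t′
        increasing   : Increasing t′
        labels-↭     : labels t′ ↭ labels t
        status-≡     : ∀ κ z → z ≢ x → statusK κ t′ z ≡ statusK κ t z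
        status-match : x ≢ root t → ∀ κ → StatusMatch (statusK κ t x) (statusK κ t′ x)

    open Correct

    root-Φ : ∀ (t : Tree k) → root (Φ x t) ≡ root t
    root-Φ (leaf y)   = refl
    root-Φ (node y v) with lookupRoot x (gcs v)
    ... | nothing = refl
    ... | just (leaf _) with maxGC v ≤ᵇ x
    ...   | true  = refl
    ...   | false = refl
    root-Φ (node y v) | just (node _ _) with maxGC v ≤ᵇ x
    ...   | true  = refl
    ...   | false = refl

    ΦL≡map : ∀ (l : List (Tree k)) → ΦL x l ≡ map (Φ x) l
    ΦL≡map []       = refl
    ΦL≡map (t ∷ ts) = cong (Φ x t ∷_) (ΦL≡map ts)

    gcs-ΦV : ∀ {n} (v : Vec (List (Tree k)) n) → gcs (ΦV x v) ≡ map (Φ x) (gcs v)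
    gcs-ΦV []      = refl
    gcs-ΦV (l ∷ v) = ≡-trans (cong₂ _++_ (ΦL≡map l) (gcs-ΦV v)) (sym (map-++ (Φ x) l (gcs v)))

    maxGC-ΦV : (v : Vec (List (Tree k)) k) → maxGC (ΦV x v) ≡ maxGC v
    maxGC-ΦV v = cong (foldr _⊔_ 0) (≡-trans (cong (map root) (gcs-ΦV v)) (roots-map root-Φ (gcs v)))

    ΦV-SortedChildren : ∀ {n} {v : Vec (List (Tree k)) n} → SortedChildren v → SortedChildren (ΦV x v)
    ΦV-SortedChildren {v = []}    []                = []
    ΦV-SortedChildren {v = l ∷ _} (linked ∷ sorted) =
      subst (Linked _<_) (sym (≡-trans (cong (map root) (ΦL≡map l)) (roots-map root-Φ l))) linked
      ∷ ΦV-SortedChildren sorted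

    leaf-correct : ∀ y → Correct (leaf y) (leaf y)
    leaf-correct y = record
      { pruned       = tt
      ; increasing   = tt
      ; labels-↭     = refl
      ; status-≡     = λ _ _ _ → refl
      ; status-match = λ x≢y κ →
          subst (λ a → StatusMatch a a) (sym (statusK-∉ κ (leaf {k} y) x λ { (here x≡y) → x≢y x≡y })) absent
      }

    statusL-gcs-ΦV : ∀ (v : Vec (List (Tree k)) k) z →
      statusL (maxGC (ΦV x v)) (gcs (ΦV x v)) z ≡ statusL (maxGC v) (map (Φ x) (gcs v)) z
    statusL-gcs-ΦV v z = cong₂ (λ m l → statusL m l z) (maxGC-ΦV v) (gcs-ΦV v)

    descend : ∀ y (v : Vec (List (Tree k)) k) → WellFormed (node y v) →
      All (λ s → root s ≢ x) (gcs v) → All (λ s → Correct s (Φ x s)) (gcs v) →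
      Correct (node y v) (node y (ΦV x v))
    descend y v (pruned₀ , inc₀ , _) roots≢x correct-gcs = record
      { pruned       = Pruned-node⁺ y (subst (Φ x t₀ ∈_) (sym (gcs-ΦV v)) (∈-map⁺ (Φ x) t₀∈))
                         (subst (All (Pruned {k})) (sym (gcs-ΦV v)) (Allₚ.map⁺ (All.map pruned correct-gcs)))
      ; increasing   = IncV⁺ (ΦV-SortedChildren (proj₁ (IncV⁻ {v = v} inc₀)))
                         (subst (All (Above y)) (sym (gcs-ΦV v))
                           (Allₚ.map⁺ (All.zipWith above-Φ (proj₂ (IncV⁻ {v = v} inc₀) , correct-gcs))))
      ; labels-↭     = labels-node-↭ y {v} {ΦV x v} (subst (λ l → labelsL l ↭ labelsL (gcs v)) (sym (gcs-ΦV v))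
                         (labelsL-map (Φ x) (All.map labels-↭ correct-gcs)))
      ; status-≡     = λ κ z z≢x → statusK-node-cong κ y {v} {ΦV x v} z λ _ →
                         ≡-trans (statusL-gcs-ΦV v z) (statusL-map (Φ x) (maxGC v) z
                           (All.map (λ {s} c → root-Φ s , λ κ → status-≡ c κ z z≢x) correct-gcs))
      ; status-match = λ x≢y κ →
          subst₂ StatusMatch (sym (statusK-node κ y v x (≢-sym x≢y)))
            (sym (≡-trans (statusK-node κ y (ΦV x v) x (≢-sym x≢y)) (statusL-gcs-ΦV v x)))
            (StatusMatch-map (Φ x) (maxGC v) x
              (All.zipWith (λ {s} (s≢x , c) → root-Φ s , status-match c (≢-sym s≢x)) (roots≢x , correct-gcs)))
      }
      where
        t₀ : Tree k
        t₀ = proj₁ (proj₁ (Pruned-node⁻ {y} {v} pruned₀))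
        t₀∈ : t₀ ∈ gcs v
        t₀∈ = proj₂ (proj₁ (Pruned-node⁻ {y} {v} pruned₀))
        above-Φ : ∀ {s} → Above y s × Correct s (Φ x s) → Above y (Φ x s)
        above-Φ {s} ((y<s , _) , c) = subst (y <_) (sym (root-Φ s)) y<s , increasing c

    unchanged : ∀ y (v : Vec (List (Tree k)) k) {s κₛ} → WellFormed (node y v) → s ∈ gcs v → root s ≡ x →
      kindOf (maxGC v) s ≡ κₛ → (κₛ , shape s) ≢ (old , internalS) → (κₛ , shape s) ≢ (young , leafS) →
      Correct (node y v) (node y v)
    unchanged y v {s} {κₛ} (pruned₀ , inc₀ , u₀) s∈ s≡x kind-s ¬oi ¬yl = record
      { pruned       = pruned₀
      ; increasing   = inc₀
      ; labels-↭     = refl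
      ; status-≡     = λ _ _ _ → refl
      ; status-match = λ x≢y κ → subst (λ a → StatusMatch a a) (sym (status-x x≢y κ)) (unrelated ¬oi ¬yl)
      }
      where
        status-x : x ≢ y → ∀ κ → statusK κ (node y v) x ≡ just (κₛ , shape s)
        status-x x≢y κ = subst (λ z → statusK κ (node y v) z ≡ just (κₛ , shape s)) s≡x
          (≡-trans (statusK-grandchild-root κ y v (Unique-labels-gcs {y} {v} u₀) s∈
                     (λ e → x≢y (≡-trans (sym s≡x) (sym e))))
                   (cong (λ κ′ → just (κ′ , shape s)) kind-s))

    module OldInternalCase (y : ℕ) (v w : Vec (List (Tree k)) k) (wf : WellFormed (node y v))
                           (s∈ : node x w ∈ gcs v) (maxGC≤x : maxGC v ≤ x) where

      collapse : Tree k → Tree k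
      collapse t = if root t ≡ᵇ x then leaf x else t

      v′ : Vec (List (Tree k)) k
      v′ = zipWith (λ l l′ → sortT (map collapse l ++ l′)) v w

      collapse-id : ∀ t → root t ≢ x → collapse t ≡ t
      collapse-id t t≢x rewrite ≢⇒≡ᵇ≡false t≢x = refl

      collapse-elim : ∀ (P : Tree k → Set) {t} → P (leaf x) → P t → P (collapse t)
      collapse-elim P {t} p-leaf p-t with root t ≡ᵇ x
      ... | true  = p-leaf
      ... | false = p-t

      root-collapse : ∀ t → root (collapse t) ≡ root t
      root-collapse t with root t ≡ᵇ x in t≡x
      ... | true  = sym (≡ᵇ≡true⇒≡ t≡x)
      ... | false = refl

      uG : Unique (labelsL (gcs v))
      uG = Unique-labels-gcs {y} {v} (proj₂ (proj₂ wf))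

      wf-s : WellFormed (node x w)
      wf-s = All.lookup (WellFormed-gcs {y} {v} wf) s∈

      uW : Unique (labelsL (gcs w))
      uW = Unique-labels-gcs {x} {w} (proj₂ (proj₂ wf-s))

      aboveG : All (Above y) (gcs v)
      aboveG = proj₂ (IncV⁻ {v = v} (proj₁ (proj₂ wf)))

      aboveW : All (Above x) (gcs w)
      aboveW = proj₂ (IncV⁻ {v = w} (proj₁ (proj₂ wf-s)))

      gcs-v′-↭ : gcs v′ ↭ map collapse (gcs v) ++ gcs w
      gcs-v′-↭ = gcs-zipWith-sortT collapse v w

      ∈-gcs-v′ : ∀ {t} → t ∈ map collapse (gcs v) ++ gcs w → t ∈ gcs v′
      ∈-gcs-v′ = ∈-resp-↭ (↭-sym gcs-v′-↭)

      All-gcs-v′ : ∀ {P : Tree k → Set} → All P (map collapse (gcs v)) → All P (gcs w) → All P (gcs v′)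
      All-gcs-v′ pG pW = All-resp-↭ (↭-sym gcs-v′-↭) (Allₚ.++⁺ pG pW)

      labels-gcs-v′ : labelsL (gcs v′) ↭ labelsL (gcs v)
      labels-gcs-v′ = begin
        labelsL (gcs v′)                                  ↭⟨ labelsL-↭ gcs-v′-↭ ⟩
        labelsL (map collapse (gcs v) ++ gcs w)           ≡⟨ labelsL-++ (map collapse (gcs v)) (gcs w) ⟩
        labelsL (map collapse (gcs v)) ++ labelsL (gcs w) ↭⟨ labelsL-map-at collapse (labelsL (gcs w)) []
                                                              (Unique-labels⇒DistinctRoots uG) s∈ collapse-id
                                                              (↭-reflexive labels-collapse-s) ⟩
        labelsL (gcs v) ++ []                             ≡⟨ ++-identityʳ (labelsL (gcs v)) ⟩
        labelsL (gcs v)                                   ∎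
        where
          open PermutationReasoning
          labels-collapse-s : labels (collapse (node x w)) ++ labelsL (gcs w) ≡ labels (node x w) ++ []
          labels-collapse-s rewrite ≡ᵇ-refl x | ++-identityʳ (labelsV w) = cong (x ∷_) (sym (labelsV≡labelsL-gcs w))

      uG′ : Unique (labelsL (gcs v′))
      uG′ = Unique-resp-↭ (↭-sym labels-gcs-v′) uG

      leaf-x∈ : leaf x ∈ gcs v′
      leaf-x∈ = ∈-gcs-v′ (∈-++⁺ˡ (subst (_∈ map collapse (gcs v)) collapse-s (∈-map⁺ collapse s∈)))
        where
          collapse-s : collapse (node x w) ≡ leaf x
          collapse-s rewrite ≡ᵇ-refl x = refl

      h₀ : Tree k
      h₀ = proj₁ (proj₁ (Pruned-node⁻ {x} {w} (proj₁ wf-s)))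

      h₀∈ : h₀ ∈ gcs w
      h₀∈ = proj₂ (proj₁ (Pruned-node⁻ {x} {w} (proj₁ wf-s)))

      x<maxGC-w : x < maxGC w
      x<maxGC-w = <-≤-trans (proj₁ (All.lookup aboveW h₀∈)) (≤-maxRoot h₀∈)

      maxGC-v′ : maxGC v′ ≡ maxGC w
      maxGC-v′ = maxRoot-cofinal (λ h∈ → ∈-gcs-v′ (∈-++⁺ʳ (map collapse (gcs v)) h∈))
        (All-gcs-v′ (Allₚ.map⁺ (All.tabulate λ {t} t∈ →
                       subst (_≤ maxGC w) (sym (root-collapse t))
                         (≤-trans (≤-maxRoot t∈) (≤-trans maxGC≤x (<⇒≤ x<maxGC-w)))))
                    (maxRoot-≤⁻ ≤-refl))

      x<maxGC-v′ : x < maxGC v′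
      x<maxGC-v′ = subst (x <_) (sym maxGC-v′) x<maxGC-w

      status-gcs : ∀ z → z ≢ x → statusL (maxGC v′) (gcs v′) z ≡ statusL (maxGC v) (gcs v) z
      status-gcs z z≢x with z ∈? labelsL (gcs v)
      ... | no z∉ = statusL-∉-↭ (maxGC v) (maxGC v′) {gcs v} {gcs v′} z labels-gcs-v′ z∉
      ... | yes z∈ with ∈-labelsL⁻ z∈
      ...   | g , g∈ , z∈g with root g ≟ x
      ...     | no g≢x = begin
        statusL (maxGC v′) (gcs v′) z     ≡⟨ statusL-∈ _ z uG′ g∈′ z∈g ⟩
        statusK (kindOf (maxGC v′) g) g z ≡⟨ cong (λ κ → statusK κ g z) (kindOf-young-cong g g<m′ g<m) ⟩
        statusK (kindOf (maxGC v) g) g z  ≡⟨ sym (statusL-∈ _ z uG g∈ z∈g) ⟩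
        statusL (maxGC v) (gcs v) z       ∎
        where
          open ≡-Reasoning
          g<x : root g < x
          g<x = ≤∧≢⇒< (≤-trans (≤-maxRoot g∈) maxGC≤x) g≢x
          g<m′ : root g < maxGC v′
          g<m′ = <-trans g<x x<maxGC-v′
          g<m : root g < maxGC v
          g<m = <-≤-trans g<x (≤-maxRoot s∈)
          g∈′ : g ∈ gcs v′
          g∈′ = ∈-gcs-v′ (∈-++⁺ˡ (subst (_∈ map collapse (gcs v)) (collapse-id g g≢x) (∈-map⁺ collapse g∈)))
      ...     | yes g≡x with root-injective (Unique-labels⇒DistinctRoots uG) g∈ s∈ g≡x
      ...       | refl with z∈g
      ...         | here z≡x = ⊥-elim (z≢x z≡x)
      ...         | there z∈w with ∈-labelsL⁻ (subst (z ∈_) (labelsV≡labelsL-gcs w) z∈w)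
      ...           | h , h∈ , z∈h = begin
        statusL (maxGC v′) (gcs v′) z                      ≡⟨ statusL-∈ _ z uG′ (∈-gcs-v′ (∈-++⁺ʳ _ h∈)) z∈h ⟩
        statusK (kindOf (maxGC v′) h) h z                  ≡⟨ cong (λ m → statusK (kindOf m h) h z) maxGC-v′ ⟩
        statusK (kindOf (maxGC w) h) h z                   ≡⟨ sym (statusK-grandchild _ x w z uW h∈ z∈h (≢-sym z≢x)) ⟩
        statusK (kindOf (maxGC v) (node x w)) (node x w) z ≡⟨ sym (statusL-∈ _ z uG s∈ (there z∈w)) ⟩
        statusL (maxGC v) (gcs v) z                        ∎
        where open ≡-Reasoning

      status-x : x ≢ y → ∀ κ →
        StatusMatch (statusK κ (node y v) x) (statusK κ (node y v′) x)
      status-x x≢y κ = subst₂ StatusMatch (sym old-internal) (sym young-leaf) oldInternal↦youngLeaf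
        where
          old-internal : statusK κ (node y v) x ≡ just (old , internalS)
          old-internal = ≡-trans (statusK-grandchild-root κ y v uG s∈ (≢-sym x≢y))
                                 (cong (λ κ′ → just (κ′ , internalS)) (kindOf-old (node x w) maxGC≤x))
          young-leaf : statusK κ (node y v′) x ≡ just (young , leafS)
          young-leaf = ≡-trans (statusK-grandchild-root κ y v′ uG′ leaf-x∈ (≢-sym x≢y))
                               (cong (λ κ′ → just (κ′ , leafS)) (kindOf-young (leaf {k} x) x<maxGC-v′))

      correct : Correct (node y v) (node y v′)
      correct = record
        { pruned       = Pruned-node⁺ y leaf-x∈
                           (All-gcs-v′ (Allₚ.map⁺ (All.map (λ {t} → collapse-elim Pruned {t} tt)
                                                            (proj₂ (Pruned-node⁻ {y} {v} (proj₁ wf)))))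
                                       (proj₂ (Pruned-node⁻ {x} {w} (proj₁ wf-s))))
        ; increasing   = IncV⁺ (zipWith-sortT-SortedChildren collapse v w
                                 (subst Unique (sym (labelsV≡labelsL-gcs v′)) uG′))
                           (All-gcs-v′ (Allₚ.map⁺ (All.map (λ {t} → above-collapse {t}) aboveG))
                                       (All.map (λ (x<h , inc) → <-trans y<x x<h , inc) aboveW))
        ; labels-↭     = labels-node-↭ y {v} {v′} labels-gcs-v′
        ; status-≡     = λ κ z z≢x → statusK-node-cong κ y {v} {v′} z (λ _ → status-gcs z z≢x)
        ; status-match = status-x
        }
        where
          y<x : y < x
          y<x = proj₁ (All.lookup aboveG s∈)
          above-collapse : ∀ {t} → Above y t → Above y (collapse t)
          above-collapse {t} (y<t , inc) =
            subst (y <_) (sym (root-collapse t)) y<t , collapse-elim Increasing {t} tt inc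

    module YoungLeafCase (y : ℕ) (v : Vec (List (Tree k)) k) (wf : WellFormed (node y v))
                         (s∈ : leaf x ∈ gcs v) (x<maxGC : x < maxGC v) where

      atMost exceeds : Tree k → Bool
      atMost  t = root t ≤ᵇ x
      exceeds t = x <ᵇ root t

      w′ : Vec (List (Tree k)) k
      w′ = V.map (λ l → sortT (filterB exceeds l)) v

      expand : Tree k → Tree k
      expand t = if root t ≡ᵇ x then node x w′ else t

      v′ : Vec (List (Tree k)) k
      v′ = V.map (λ l → map expand (filterB atMost l)) v

      expand-id : ∀ t → root t ≢ x → expand t ≡ t
      expand-id t t≢x rewrite ≢⇒≡ᵇ≡false t≢x = refl

      expand-elim : ∀ (P : Tree k → Set) {t} → P (node x w′) → P t → P (expand t)
      expand-elim P {t} p-node p-t with root t ≡ᵇ x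
      ... | true  = p-node
      ... | false = p-t

      root-expand : ∀ t → root (expand t) ≡ root t
      root-expand t with root t ≡ᵇ x in t≡x
      ... | true  = sym (≡ᵇ≡true⇒≡ t≡x)
      ... | false = refl

      exceeds≡not-atMost : ∀ t → exceeds t ≡ not (atMost t)
      exceeds≡not-atMost t with atMost t in t≤x
      ... | true  = ¬T⇒≡false (λ x<t → <⇒≱ (<ᵇ⇒< x (root t) x<t) (≤ᵇ≡true⇒≤ {root t} t≤x))
      ... | false = Equivalence.to T-≡ (<⇒<ᵇ (≤ᵇ≡false⇒> {root t} t≤x))

      kept moved : List (Tree k)
      kept  = filterB atMost (gcs v)
      moved = filterB exceeds (gcs v)

      uG : Unique (labelsL (gcs v))
      uG = Unique-labels-gcs {y} {v} (proj₂ (proj₂ wf))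

      prunedG : All Pruned (gcs v)
      prunedG = proj₂ (Pruned-node⁻ {y} {v} (proj₁ wf))

      aboveG : All (Above y) (gcs v)
      aboveG = proj₂ (IncV⁻ {v = v} (proj₁ (proj₂ wf)))

      gcs-v′≡ : gcs v′ ≡ map expand kept
      gcs-v′≡ = gcs-map-filterB expand atMost v

      gcs-w′-↭ : gcs w′ ↭ moved
      gcs-w′-↭ = gcs-sortT-filterB exceeds v

      ∈-gcs-w′ : ∀ {t} → t ∈ gcs v → atMost t ≡ false → t ∈ gcs w′
      ∈-gcs-w′ {t} t∈ t>x =
        ∈-resp-↭ (↭-sym gcs-w′-↭) (filterB-∈⁺ exceeds t∈ (≡-trans (exceeds≡not-atMost t) (cong not t>x)))

      ∈-gcs-v′ : ∀ {t} → t ∈ gcs v → atMost t ≡ true → expand t ∈ gcs v′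
      ∈-gcs-v′ {t} t∈ t≤x = subst (expand t ∈_) (sym gcs-v′≡) (∈-map⁺ expand (filterB-∈⁺ atMost t∈ t≤x))

      x∈kept : leaf x ∈ kept
      x∈kept = filterB-∈⁺ atMost {l = gcs v} s∈ (≤⇒≤ᵇ≡true (≤-refl {x}))

      labels-gcs-v′ : labelsL (gcs v′) ↭ labelsL (gcs v)
      labels-gcs-v′ = begin
        labelsL (gcs v′)                      ≡⟨ cong labelsL gcs-v′≡ ⟩
        labelsL (map expand kept)             ≡⟨ sym (++-identityʳ _) ⟩
        labelsL (map expand kept) ++ []       ↭⟨ labelsL-map-at expand {l = kept} [] (labelsL (gcs w′))
                                                   (filterB-AllPairs atMost (Unique-labels⇒DistinctRoots {l = gcs v} uG))
                                                   x∈kept expand-id (↭-reflexive labels-expand-s) ⟩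
        labelsL kept ++ labelsL (gcs w′)      ↭⟨ ++⁺ˡ (labelsL kept) (labelsL-↭ gcs-w′-↭) ⟩
        labelsL kept ++ labelsL moved         ≡⟨ sym (labelsL-++ kept moved) ⟩
        labelsL (kept ++ moved)               ↭⟨ labelsL-↭ (filterB-complement-↭ atMost exceeds (gcs v) exceeds≡not-atMost) ⟩
        labelsL (gcs v)                       ∎
        where
          open PermutationReasoning
          labels-expand-s : labels (expand (leaf x)) ++ [] ≡ labels (leaf {k} x) ++ labelsL (gcs w′)
          labels-expand-s rewrite ≡ᵇ-refl x | ++-identityʳ (labelsV w′) = cong (x ∷_) (labelsV≡labelsL-gcs w′)

      uG′ : Unique (labelsL (gcs v′))
      uG′ = Unique-resp-↭ (↭-sym labels-gcs-v′) uG

      ν∈ : node x w′ ∈ gcs v′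
      ν∈ = subst (_∈ gcs v′) expand-s (∈-gcs-v′ s∈ (≤⇒≤ᵇ≡true (≤-refl {x})))
        where
          expand-s : expand (leaf x) ≡ node x w′
          expand-s rewrite ≡ᵇ-refl x = refl

      uW′ : Unique (labelsL (gcs w′))
      uW′ with Unique-labels-∈ uG′ ν∈
      ... | _ ∷ u = subst Unique (labelsV≡labelsL-gcs w′) u

      g₀ : Tree k
      g₀ = proj₁ (<-maxRoot⁻ {l = gcs v} x<maxGC)

      g₀∈ : g₀ ∈ gcs v
      g₀∈ = proj₁ (proj₂ (<-maxRoot⁻ {l = gcs v} x<maxGC))

      x<g₀ : x < root g₀
      x<g₀ = proj₂ (proj₂ (<-maxRoot⁻ {l = gcs v} x<maxGC))

      g₀∈w′ : g₀ ∈ gcs w′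
      g₀∈w′ = ∈-gcs-w′ g₀∈ (>⇒≤ᵇ≡false x<g₀)

      maxGC-w′ : maxGC w′ ≡ maxGC v
      maxGC-w′ = sym (maxRoot-cofinal (λ t∈ → proj₁ (filterB-∈⁻ exceeds (∈-resp-↭ gcs-w′-↭ t∈)))
        (All.tabulate λ {t} t∈ → bounded t∈))
        where
          bounded : ∀ {t} → t ∈ gcs v → root t ≤ maxGC w′
          bounded {t} t∈ with atMost t in t≤x
          ... | true  = ≤-trans (≤ᵇ≡true⇒≤ t≤x) (<⇒≤ (<-≤-trans x<g₀ (≤-maxRoot g₀∈w′)))
          ... | false = ≤-maxRoot (∈-gcs-w′ t∈ t≤x)

      maxGC-v′≤x : maxGC v′ ≤ x
      maxGC-v′≤x = maxRoot-≤ (subst (All (λ t → root t ≤ x)) (sym gcs-v′≡) (Allₚ.map⁺ (All.tabulate λ {t} t∈ →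
        subst (_≤ x) (sym (root-expand t)) (≤ᵇ≡true⇒≤ (proj₂ (filterB-∈⁻ atMost {l = gcs v} t∈))))))

      x≤maxGC-v′ : x ≤ maxGC v′
      x≤maxGC-v′ = ≤-maxRoot ν∈

      status-gcs : ∀ z → z ≢ x → statusL (maxGC v′) (gcs v′) z ≡ statusL (maxGC v) (gcs v) z
      status-gcs z z≢x with z ∈? labelsL (gcs v)
      ... | no z∉ = statusL-∉-↭ (maxGC v) (maxGC v′) {gcs v} {gcs v′} z labels-gcs-v′ z∉
      ... | yes z∈ with ∈-labelsL⁻ z∈
      ...   | g , g∈ , z∈g with root g ≟ x
      ...     | yes g≡x with root-injective (Unique-labels⇒DistinctRoots uG) g∈ s∈ g≡x
      ...       | refl with z∈g
      ...         | here z≡x = ⊥-elim (z≢x z≡x)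
      status-gcs z z≢x | yes z∈ | g , g∈ , z∈g | no g≢x with atMost g in g≤x
      ... | true = begin
        statusL (maxGC v′) (gcs v′) z     ≡⟨ statusL-∈ _ z uG′ g∈′ z∈g ⟩
        statusK (kindOf (maxGC v′) g) g z ≡⟨ cong (λ κ → statusK κ g z) (kindOf-young-cong g g<m′ g<m) ⟩
        statusK (kindOf (maxGC v) g) g z  ≡⟨ sym (statusL-∈ _ z uG g∈ z∈g) ⟩
        statusL (maxGC v) (gcs v) z       ∎
        where
          open ≡-Reasoning
          g<x : root g < x
          g<x = ≤∧≢⇒< (≤ᵇ≡true⇒≤ {root g} g≤x) g≢x
          g<m′ : root g < maxGC v′
          g<m′ = <-≤-trans g<x x≤maxGC-v′
          g<m : root g < maxGC v
          g<m = <-trans g<x x<maxGC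
          g∈′ : g ∈ gcs v′
          g∈′ = subst (_∈ gcs v′) (expand-id g g≢x) (∈-gcs-v′ g∈ g≤x)
      ... | false = begin
        statusL (maxGC v′) (gcs v′) z                         ≡⟨ statusL-∈ _ z uG′ ν∈ (there z∈w′) ⟩
        statusK (kindOf (maxGC v′) (node x w′)) (node x w′) z ≡⟨ statusK-grandchild _ x w′ z uW′ g∈w′ z∈g (≢-sym z≢x) ⟩
        statusK (kindOf (maxGC w′) g) g z                     ≡⟨ cong (λ m → statusK (kindOf m g) g z) maxGC-w′ ⟩
        statusK (kindOf (maxGC v) g) g z                      ≡⟨ sym (statusL-∈ _ z uG g∈ z∈g) ⟩
        statusL (maxGC v) (gcs v) z                           ∎
        where
          open ≡-Reasoning
          g∈w′ : g ∈ gcs w′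
          g∈w′ = ∈-gcs-w′ g∈ g≤x
          z∈w′ : z ∈ labelsV w′
          z∈w′ = subst (z ∈_) (sym (labelsV≡labelsL-gcs w′)) (∈-labelsL⁺ g∈w′ z∈g)

      status-x : x ≢ y → ∀ κ →
        StatusMatch (statusK κ (node y v) x) (statusK κ (node y v′) x)
      status-x x≢y κ = subst₂ StatusMatch (sym young-leaf) (sym old-internal) (unrelated (λ ()) (λ ()))
        where
          young-leaf : statusK κ (node y v) x ≡ just (young , leafS)
          young-leaf = ≡-trans (statusK-grandchild-root κ y v uG s∈ (≢-sym x≢y))
                               (cong (λ κ′ → just (κ′ , leafS)) (kindOf-young (leaf {k} x) x<maxGC))
          old-internal : statusK κ (node y v′) x ≡ just (old , internalS)
          old-internal = ≡-trans (statusK-grandchild-root κ y v′ uG′ ν∈ (≢-sym x≢y))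
                                 (cong (λ κ′ → just (κ′ , internalS)) (kindOf-old (node x w′) maxGC-v′≤x))

      correct : Correct (node y v) (node y v′)
      correct = record
        { pruned       = Pruned-node⁺ y ν∈ (subst (All Pruned) (sym gcs-v′≡)
                           (Allₚ.map⁺ (All.map (λ {t} → expand-elim Pruned {t} pruned-ν) (filterB-All atMost prunedG))))
        ; increasing   = IncV⁺ (map-filterB-SortedChildren expand atMost root-expand
                                 (proj₁ (IncV⁻ {v = v} (proj₁ (proj₂ wf)))))
                           (subst (All (Above y)) (sym gcs-v′≡)
                             (Allₚ.map⁺ (All.map (λ {t} → above-expand {t}) (filterB-All atMost aboveG))))
        ; labels-↭     = labels-node-↭ y {v} {v′} labels-gcs-v′
        ; status-≡     = λ κ z z≢x → statusK-node-cong κ y {v} {v′} z (λ _ → status-gcs z z≢x)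
        ; status-match = status-x
        }
        where
          pruned-ν : Pruned (node x w′)
          pruned-ν = Pruned-node⁺ x g₀∈w′ (All-resp-↭ (↭-sym gcs-w′-↭) (filterB-All exceeds prunedG))
          above-w′ : All (Above x) (gcs w′)
          above-w′ = All-resp-↭ (↭-sym gcs-w′-↭) (All.tabulate λ {t} t∈ →
            let t∈G , x<t = filterB-∈⁻ exceeds {l = gcs v} t∈
            in <ᵇ≡true⇒< x<t , proj₂ (All.lookup aboveG t∈G))
          increasing-ν : Increasing (node x w′)
          increasing-ν = IncV⁺ (map-sortT-SortedChildren exceeds v (subst Unique (sym (labelsV≡labelsL-gcs w′)) uW′))
                               above-w′
          above-expand : ∀ {t} → Above y t → Above y (expand t)
          above-expand {t} (y<t , inc) =
            subst (y <_) (sym (root-expand t)) y<t , expand-elim Increasing {t} increasing-ν inc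

    mutual
      correct : ∀ (t : Tree k) → WellFormed t → Correct t (Φ x t)
      correct (leaf y)   _  = leaf-correct y
      correct (node y v) wf with lookupRoot x (gcs v) in found
      ... | nothing = descend y v wf (lookupRoot-nothing x (gcs v) found)
                        (All.zipWith (λ (c , wf-s) → c wf-s) (correctV v , WellFormed-gcs {y} {v} wf))
      ... | just (leaf _) with lookupRoot-just x (gcs v) found
      ...   | s∈ , refl with maxGC v ≤ᵇ x in m≤x
      ...     | true  = unchanged y v wf s∈ refl
                          (kindOf-old {m = maxGC v} (leaf {k} x) (≤ᵇ≡true⇒≤ m≤x)) (λ ()) (λ ())
      ...     | false = YoungLeafCase.correct y v wf s∈ (≤ᵇ≡false⇒> m≤x)
      correct (node y v) wf | just (node _ w) with lookupRoot-just x (gcs v) found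
      ...   | s∈ , refl with maxGC v ≤ᵇ x in m≤x
      ...     | true  = OldInternalCase.correct y v w wf s∈ (≤ᵇ≡true⇒≤ m≤x)
      ...     | false = unchanged y v wf s∈ refl
                          (kindOf-young {m = maxGC v} (node x w) (≤ᵇ≡false⇒> m≤x)) (λ ()) (λ ())

      correctV : ∀ {n} (v : Vec (List (Tree k)) n) → All (λ s → WellFormed s → Correct s (Φ x s)) (gcs v)
      correctV []      = []
      correctV (l ∷ v) = Allₚ.++⁺ (correctL l) (correctV v)

      correctL : ∀ (l : List (Tree k)) → All (λ s → WellFormed s → Correct s (Φ x s)) l
      correctL []       = []
      correctL (t ∷ ts) = correct t ∷ correctL ts

lemma4p2 : (k : ℕ) → 1 ≤ k → (M : List ℕ) → Unique M → All (λ m → 0 < m) M →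
    (T : Tree k) → InT M T → (x : ℕ) → x ∈ M →
    InT M (Φ x T)
    × (OldInternal T x ⇔ YoungLeaf (Φ x T) x)
    × (∀ y → y ∈ M → y ≢ x → status (Φ x T) y ≡ status T y)
lemma4p2 k _ M unique-M _ T (pruned-T , increasing-T , labels-T) x _ =
  (Correct.pruned R , Correct.increasing R , trans (Correct.labels-↭ R) labels-T) ,
  StatusMatch⇒⇔ status-x ,
  λ y _ y≢x → Correct.status-≡ R isRoot y y≢x
  where
    R : Correct x T (Φ x T)
    R = correct x T (pruned-T , increasing-T , Unique-resp-↭ (↭-sym labels-T) unique-M)
    status-x : StatusMatch (status T x) (status (Φ x T) x)
    status-x with x ≟ root T
    ... | no  x≢root = Correct.status-match R x≢root isRoot
    ... | yes refl   = subst₂ StatusMatch (sym (statusK-root isRoot T))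
      (sym (≡-trans (cong (statusK isRoot (Φ x T)) (sym (root-Φ x T))) (statusK-root isRoot (Φ x T))))
      (unrelated (λ ()) (λ ()))
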